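{- For every polyomino $P$, the bipartite graph $G(P)$ is connected.
   Context: A polyomino is a finite union of unit squares (tiles) of the standard grid in $\mathbb{R}^2$ with connected interior. Two tiles of $P$ are in the same row (resp. column) of $P$ if the segment joining their centers is horizontal (resp. vertical) and contained in $P$; rows and columns of $P$ are the resulting equivalence classes of tiles. The graph $G(P)$ is the bipartite graph whose vertex set is the set of rows of $P$ together with the set of columns of $P$, with an edge between a row $r$ and a column $c$ for each tile lying in both $r$ and $c$. -}

module Defs where

open import Data.Integer using (ℤ; _+_; _≤_; 1ℤ)
open import Data.Product using (_×_; _,_; Σ; ∃)
open import Data.Sum using (_⊎_)
open import Data.List using (List)
open import Data.List.Membership.Propositional using (_∈_)
open import Relation.Binary.PropositionalEquality using (_≡_)

-- A tile (unit square) of the standard grid, identified by the integer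
-- coordinates (x , y) of its lower-left corner: the square [x,x+1]×[y,y+1].
Cell : Set
Cell = ℤ × ℤ

Adjacent : Cell → Cell → Set
Adjacent (x , y) (x' , y') =
  (x ≡ x' × (y' ≡ y + 1ℤ ⊎ y ≡ y' + 1ℤ)) ⊎
  (y ≡ y' × (x' ≡ x + 1ℤ ⊎ x ≡ x' + 1ℤ))

data Chain (T : List Cell) : Cell → Cell → Set where
  here : ∀ {a} → a ∈ T → Chain T a a
  step : ∀ {a b c} → a ∈ T → Adjacent a b → Chain T b c → Chain T a c

-- A finite union of tiles has connected interior iff its tiles are
-- connected through edge-adjacency.
record Polyomino : Set where
  constructor polyomino
  field
    tiles     : List Cell
    connected : ∀ {a b} → a ∈ tiles → b ∈ tiles → Chain tiles a b
open Polyomino public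

Between : ℤ → ℤ → ℤ → Set
Between z a b = (a ≤ z × z ≤ b) ⊎ (b ≤ z × z ≤ a)

-- Two tiles of P lie in the same row of P: the segment joining their
-- centres is horizontal and contained in P, i.e. same y and every tile
-- in between (inclusive) belongs to P.
SameRow : Polyomino → Cell → Cell → Set
SameRow P (x , y) (x' , y') =
  (x , y) ∈ tiles P × (x' , y') ∈ tiles P × y ≡ y' ×
  (∀ z → Between z x x' → (z , y) ∈ tiles P)

SameCol : Polyomino → Cell → Cell → Set
SameCol P (x , y) (x' , y') =
  (x , y) ∈ tiles P × (x' , y') ∈ tiles P × x ≡ x' ×
  (∀ z → Between z y y' → (x , z) ∈ tiles P)

-- Vertices of G(P): a row or a column of P, given by a representative tile.
data Kind : Set where
  row col : Kind

Vertex : Polyomino → Set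
Vertex P = Kind × Σ Cell (λ t → t ∈ tiles P)

-- Two representatives denote the same vertex (same equivalence class).
SameVertex : (P : Polyomino) → Vertex P → Vertex P → Set
SameVertex P (row , t , _) (row , t' , _) = SameRow P t t'
SameVertex P (col , t , _) (col , t' , _) = SameCol P t t'
SameVertex P (row , _) (col , _) = Data.Empty.⊥ where import Data.Empty
SameVertex P (col , _) (row , _) = Data.Empty.⊥ where import Data.Empty

Edge : (P : Polyomino) → Vertex P → Vertex P → Set
Edge P (row , r , _) (col , c , _) = ∃ λ t → SameRow P r t × SameCol P c t
Edge P (col , c , _) (row , r , _) = ∃ λ t → SameRow P r t × SameCol P c t
Edge P (row , _) (row , _) = Data.Empty.⊥ where import Data.Empty
Edge P (col , _) (col , _) = Data.Empty.⊥ where import Data.Empty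

data Walk (P : Polyomino) : Vertex P → Vertex P → Set where
  stay : ∀ {u v} → SameVertex P u v → Walk P u v
  go   : ∀ {u w v} → Edge P u w → Walk P w v → Walk P u v

GConnected : Polyomino → Set
GConnected P = ∀ (u v : Vertex P) → Walk P u v

-- Tiles joined by a chain of edge-adjacent tiles are linked in G(P): a
-- horizontal (vertical) step a → b shows that b lies in the row (column)
-- of a, so the row (column) of a is joined to the column (row) of b by the
-- edge b; and at each tile its row and its column are joined by that tile.
-- Since the tiles of a polyomino are chain-connected, so is G(P).
module Submission where

open import Defs
open import Data.Integer using (_+_; _≤_; 1ℤ; _≤?_)
open import Data.Integer.Properties
  using (≤-antisym; ≤-trans; ≰⇒>; i<j⇒suc[i]≤j; suc[i]≤j⇒i<j; <-irrefl; +-comm)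
open import Data.Product using (_,_; ∃)
open import Data.Sum using (_⊎_; inj₁; inj₂; [_,_])
open import Data.Empty using (⊥-elim)
open import Data.List.Membership.Propositional using (_∈_)
open import Relation.Binary.PropositionalEquality using (_≡_; refl; sym; subst)
open import Relation.Nullary using (yes; no)

Between-sym : ∀ {z a b} → Between z a b → Between z b a
Between-sym (inj₁ p) = inj₂ p
Between-sym (inj₂ p) = inj₁ p

Between-same⇒≡ : ∀ {z a} → Between z a a → z ≡ a
Between-same⇒≡ (inj₁ (a≤z , z≤a)) = ≤-antisym z≤a a≤z
Between-same⇒≡ (inj₂ (a≤z , z≤a)) = ≤-antisym z≤a a≤z

Between-+1 : ∀ {z a} → Between z a (a + 1ℤ) → z ≡ a ⊎ z ≡ a + 1ℤ
Between-+1 {z} {a} (inj₁ (a≤z , z≤a+1)) with z ≤? a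
... | yes z≤a = inj₁ (≤-antisym z≤a a≤z)
... | no  z≰a = inj₂ (≤-antisym z≤a+1 (subst (_≤ z) (+-comm 1ℤ a) (i<j⇒suc[i]≤j (≰⇒> z≰a))))
Between-+1 {z} {a} (inj₂ (a+1≤z , z≤a)) =
  ⊥-elim (<-irrefl refl (suc[i]≤j⇒i<j (subst (_≤ a) (+-comm a 1ℤ) (≤-trans a+1≤z z≤a))))

module _ (P : Polyomino) where

  SameRow-refl : ∀ {t} → t ∈ tiles P → SameRow P t t
  SameRow-refl {x , y} t∈P =
    t∈P , t∈P , refl , λ z z∈[x,x] → subst (λ w → (w , y) ∈ tiles P) (sym (Between-same⇒≡ z∈[x,x])) t∈P

  SameCol-refl : ∀ {t} → t ∈ tiles P → SameCol P t t
  SameCol-refl {x , y} t∈P =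
    t∈P , t∈P , refl , λ z z∈[y,y] → subst (λ w → (x , w) ∈ tiles P) (sym (Between-same⇒≡ z∈[y,y])) t∈P

  SameRow-sym : ∀ {a b} → SameRow P a b → SameRow P b a
  SameRow-sym (a∈P , b∈P , refl , segment) = b∈P , a∈P , refl , λ z z∈ → segment z (Between-sym z∈)

  SameCol-sym : ∀ {a b} → SameCol P a b → SameCol P b a
  SameCol-sym (a∈P , b∈P , refl , segment) = b∈P , a∈P , refl , λ z z∈ → segment z (Between-sym z∈)

  SameRow-+1 : ∀ {x y} → (x , y) ∈ tiles P → (x + 1ℤ , y) ∈ tiles P → SameRow P (x , y) (x + 1ℤ , y)
  SameRow-+1 a∈P b∈P = a∈P , b∈P , refl , λ z z∈ → [ (λ { refl → a∈P }) , (λ { refl → b∈P }) ] (Between-+1 z∈)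

  SameCol-+1 : ∀ {x y} → (x , y) ∈ tiles P → (x , y + 1ℤ) ∈ tiles P → SameCol P (x , y) (x , y + 1ℤ)
  SameCol-+1 a∈P b∈P = a∈P , b∈P , refl , λ z z∈ → [ (λ { refl → a∈P }) , (λ { refl → b∈P }) ] (Between-+1 z∈)

  SameLine : Kind → Cell → Cell → Set
  SameLine row = SameRow P
  SameLine col = SameCol P

  adjacent⇒SameLine : ∀ {a b} → a ∈ tiles P → b ∈ tiles P → Adjacent a b → ∃ λ k → SameLine k a b
  adjacent⇒SameLine a∈P b∈P (inj₁ (refl , inj₁ refl)) = col , SameCol-+1 a∈P b∈P
  adjacent⇒SameLine a∈P b∈P (inj₁ (refl , inj₂ refl)) = col , SameCol-sym (SameCol-+1 b∈P a∈P)
  adjacent⇒SameLine a∈P b∈P (inj₂ (refl , inj₁ refl)) = row , SameRow-+1 a∈P b∈P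
  adjacent⇒SameLine a∈P b∈P (inj₂ (refl , inj₂ refl)) = row , SameRow-sym (SameRow-+1 b∈P a∈P)

  other : Kind → Kind
  other row = col
  other col = row

  Edge-SameLine : ∀ k {a b} (a∈P : a ∈ tiles P) (b∈P : b ∈ tiles P) →
                  SameLine k a b → Edge P (k , a , a∈P) (other k , b , b∈P)
  Edge-SameLine row a∈P b∈P ab = _ , ab , SameCol-refl b∈P
  Edge-SameLine col a∈P b∈P ab = _ , SameRow-refl b∈P , ab

  Walk-switchKind : ∀ k j {t} (t∈P : t ∈ tiles P) {v} → Walk P (j , t , t∈P) v → Walk P (k , t , t∈P) v
  Walk-switchKind row row t∈P w = w
  Walk-switchKind col col t∈P w = w
  Walk-switchKind row col t∈P w = go (Edge-SameLine row t∈P t∈P (SameRow-refl t∈P)) w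
  Walk-switchKind col row t∈P w = go (Edge-SameLine col t∈P t∈P (SameCol-refl t∈P)) w

  chain-head : ∀ {a b} → Chain (tiles P) a b → a ∈ tiles P
  chain-head (here a∈P)     = a∈P
  chain-head (step a∈P _ _) = a∈P

  chain⇒Walk : ∀ {a b} → Chain (tiles P) a b → ∀ k k' (a∈P : a ∈ tiles P) (b∈P : b ∈ tiles P) →
               Walk P (k , a , a∈P) (k' , b , b∈P)
  chain⇒Walk (here _) k k' a∈P b∈P =
    Walk-switchKind k k' a∈P (stay (SameVertex-refl k'))
    where
    SameVertex-refl : ∀ k' → SameVertex P (k' , _ , a∈P) (k' , _ , b∈P)
    SameVertex-refl row = SameRow-refl a∈P
    SameVertex-refl col = SameCol-refl a∈P
  chain⇒Walk (step _ ab chain) k k' a∈P c∈P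
    with b∈P ← chain-head chain
    with j , line ← adjacent⇒SameLine a∈P b∈P ab =
    Walk-switchKind k j a∈P (go (Edge-SameLine j a∈P b∈P line) (chain⇒Walk chain (other j) k' b∈P c∈P))

lemma16 : (P : Polyomino) → GConnected P
lemma16 P (k , a , a∈P) (k' , b , b∈P) = chain⇒Walk P (connected P a∈P b∈P) k k' a∈P b∈P
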